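{- Let $r,s$ be positive integers and let $\{P_1,\ldots,P_m\}$ be a set of representatives of the main classes of $\mathcal{SOR}_{r,s-1;s-1}$. Then for every $P\in\mathcal{SOR}_{r,s;s}$ there exist $i\leq m$ and $Q\in\mathcal{SOR}^{P_i}_{r,s;s}$ such that $P$ and $Q$ are in the same main class (of $\mathcal{SOR}_{r,s}$).
   Context: An $r\times r$ partial Latin rectangle based on $[t]=\{1,\ldots,t\}$ ($[0]=\emptyset$) is an $r\times r$ array whose cells are empty or contain a symbol of $[t]$, each symbol occurring at most once per row and per column. Two such arrays $P=(p_{ij}),Q=(q_{ij})$ are orthogonal if whenever $p_{ij}=p_{i'j'}\in[t]$ for distinct cells, $q_{ij}$ and $q_{i'j'}$ are not the same symbol; $P$ is self-orthogonal if orthogonal to its transpose $P^t$. $\mathcal{SOR}_{r,t}$ denotes the set of self-orthogonal $r\times r$ partial Latin rectangles based on $[t]$, and $\mathcal{SOR}_{r,t;t}$ its subset of those containing exactly $t$ distinct symbols ($\mathcal{SOR}_{r,0;0}$ consists only of the empty array). For $P'\in\mathcal{SOR}_{r,s-1;s-1}$, $\mathcal{SOR}^{P'}_{r,s;s}$ is the set of $Q\in\mathcal{SOR}_{r,s;s}$ such that emptying the cells of $Q$ containing the symbol $s$ yields $P'$. A paratopism is a triple $(\alpha,\gamma,\pi)$ with $\alpha\in S_r$, $\gamma\in S_t$, $\pi\in\{\mathrm{id},(12)\}$; it sends $P$ to the array obtained by first transposing $P$ if $\pi=(12)$ and then moving the entry of cell $(i,j)$ to cell $(\alpha(i),\alpha(j))$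 and replacing each symbol $k$ by $\gamma(k)$. Two elements of $\mathcal{SOR}_{r,t}$ are in the same main class if one is the image of the other under such a paratopism. -}

module Defs where

open import Data.Nat using (ℕ; suc)
open import Data.Fin using (Fin; fromℕ; inject₁)
open import Data.Fin.Permutation using (Permutation′; _⟨$⟩ˡ_)
open import Data.Maybe using (Maybe; just; nothing)
import Data.Maybe as M
open import Data.Bool using (Bool; true; false)
open import Data.Product using (Σ; ∃; _×_; _,_)
open import Data.Sum using (_⊎_)
open import Relation.Binary.PropositionalEquality using (_≡_; _≢_)
open import Relation.Nullary using (¬_)

-- An r × r array whose cells are empty (nothing) or contain a symbol of [t] ≅ Fin t.
Array : ℕ → ℕ → Set
Array r t = Fin r → Fin r → Maybe (Fin t)

Cell : ℕ → Set
Cell r = Fin r × Fin r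

at : ∀ {r t} → Array r t → Cell r → Maybe (Fin t)
at P (i , j) = P i j

IsPLR : ∀ {r t} → Array r t → Set
IsPLR {r} {t} P =
  (∀ (i j j' : Fin r) (k : Fin t) → P i j ≡ just k → P i j' ≡ just k → j ≡ j')
  × (∀ (i i' j : Fin r) (k : Fin t) → P i j ≡ just k → P i' j ≡ just k → i ≡ i')

transpose : ∀ {r t} → Array r t → Array r t
transpose P i j = P j i

Orthogonal : ∀ {r t} → Array r t → Array r t → Set
Orthogonal {r} {t} P Q =
  ∀ (c c' : Cell r) (k : Fin t) → c ≢ c' → at P c ≡ just k → at P c' ≡ just k →
    ¬ (Σ (Fin t) λ l → at Q c ≡ just l × at Q c' ≡ just l)

IsSOR : ∀ {r t} → Array r t → Set
IsSOR P = IsPLR P × Orthogonal P (transpose P)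

AllSymbolsUsed : ∀ {r t} → Array r t → Set
AllSymbolsUsed {r} {t} P = ∀ (k : Fin t) → Σ (Fin r) λ i → Σ (Fin r) λ j → P i j ≡ just k

IsSORExact : ∀ {r t} → Array r t → Set
IsSORExact P = IsSOR P × AllSymbolsUsed P

-- image of P under paratopism (α, γ, π); π = true means (12), i.e. transpose first.
-- Entry of cell (i,j) moves to (α i, α j), so the image at (i,j) is the entry at (α⁻¹ i, α⁻¹ j).
paratopism : ∀ {r t} → Permutation′ r → Permutation′ t → Bool → Array r t → Array r t
paratopism α γ false P i j = M.map (γ Data.Fin.Permutation.⟨$⟩ʳ_) (P (α ⟨$⟩ˡ i) (α ⟨$⟩ˡ j))
paratopism α γ true  P i j = M.map (γ Data.Fin.Permutation.⟨$⟩ʳ_) (transpose P (α ⟨$⟩ˡ i) (α ⟨$⟩ˡ j))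

SameMainClass : ∀ {r t} → Array r t → Array r t → Set
SameMainClass {r} {t} P Q =
  Σ (Permutation′ r) λ α → Σ (Permutation′ t) λ γ → Σ Bool λ π →
    ∀ i j → paratopism α γ π P i j ≡ Q i j

-- emptying the cells of Q containing the symbol s = suc k (here the top element fromℕ k)
-- yields P'  (symbols of [k] embedded into [k+1] via inject₁)
ExtendsTo : ∀ {r k} → Array r k → Array r (suc k) → Set
ExtendsTo {r} {k} P' Q =
  ∀ (i j : Fin r) → (Q i j ≡ just (fromℕ k) × P' i j ≡ nothing) ⊎ Q i j ≡ M.map inject₁ (P' i j)

IsSORExtending : ∀ {r k} → Array r k → Array r (suc k) → Set
IsSORExtending P' Q = IsSORExact Q × ExtendsTo P' Q

IsMainClassReps : ∀ {r t m} → (Fin m → Array r t) → Set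
IsMainClassReps {r} {t} {m} Reps =
  (∀ a → IsSORExact (Reps a))
  × (∀ (P : Array r t) → IsSORExact P → Σ (Fin m) λ a → SameMainClass (Reps a) P)
  × (∀ a b → SameMainClass (Reps a) (Reps b) → a ≡ b)

module Submission where

-- Deleting the largest symbol s = suc k from P ∈ SOR_{r,s;s}
-- gives an array P′ ∈ SOR_{r,k;k}, so some representative Reps a is carried
-- onto P′ by a paratopism (α, γ, π).  Extend γ to a permutation of [s] that
-- fixes s; applying the inverse paratopism (α⁻¹, γ⁻¹ extended, π) to P gives
-- an array Q in the main class of P.  Deleting s commutes with paratopisms
-- whose symbol permutation fixes s, so deleting s from Q yields exactly
-- Reps a, i.e. Q ∈ SOR^{Reps a}_{r,s;s}.

open import Defs
open import Data.Nat using (ℕ; suc; _≤_)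
open import Data.Fin using (Fin; fromℕ; inject₁)
open import Data.Fin.Relation.Unary.Top using (View; ‵fromℕ; ‵inject₁; view; view-fromℕ; view-inject₁)
open import Data.Fin.Permutation using (Permutation′; _⟨$⟩ʳ_; _⟨$⟩ˡ_; inverseˡ; inverseʳ; permutation; flip)
open import Data.Maybe using (Maybe; just; nothing)
import Data.Maybe as M
open import Data.Maybe.Properties using (just-injective)
open import Data.Bool using (Bool; true; false)
open import Data.Product using (Σ; _×_; _,_; proj₁; proj₂)
open import Data.Sum using (_⊎_; inj₁; inj₂)
open import Function using (_∘_)
open import Function.Definitions using (Injective)
open import Relation.Binary.PropositionalEquality
open ≡-Reasoning

private
  variable
    r s t k : ℕ

top-or-old : (x : Fin (suc k)) → x ≡ fromℕ k ⊎ Σ (Fin k) λ y → x ≡ inject₁ y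
top-or-old x = classify (view x)
  where
  classify : ∀ {x} → View x → x ≡ fromℕ _ ⊎ Σ (Fin _) λ y → x ≡ inject₁ y
  classify ‵fromℕ        = inj₁ refl
  classify (‵inject₁ y) = inj₂ (y , refl)

liftTopView : (Fin k → Fin k) → {x : Fin (suc k)} → View x → Fin (suc k)
liftTopView {k} f ‵fromℕ        = fromℕ k
liftTopView     f (‵inject₁ y) = inject₁ (f y)

liftTop : (Fin k → Fin k) → Fin (suc k) → Fin (suc k)
liftTop f x = liftTopView f (view x)

liftTop-fromℕ : (f : Fin k → Fin k) → liftTop f (fromℕ k) ≡ fromℕ k
liftTop-fromℕ {k} f = cong (liftTopView f) (view-fromℕ k)

liftTop-inject₁ : (f : Fin k → Fin k) (y : Fin k) → liftTop f (inject₁ y) ≡ inject₁ (f y)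
liftTop-inject₁ f y = cong (liftTopView f) (view-inject₁ y)

liftTop-inverse : (f g : Fin k → Fin k) → (∀ y → g (f y) ≡ y) → ∀ x → liftTop g (liftTop f x) ≡ x
liftTop-inverse f g g∘f≡id x with top-or-old x
... | inj₁ refl = trans (cong (liftTop g) (liftTop-fromℕ f)) (liftTop-fromℕ g)
... | inj₂ (y , refl) = begin
  liftTop g (liftTop f (inject₁ y)) ≡⟨ cong (liftTop g) (liftTop-inject₁ f y) ⟩
  liftTop g (inject₁ (f y))         ≡⟨ liftTop-inject₁ g (f y) ⟩
  inject₁ (g (f y))                 ≡⟨ cong inject₁ (g∘f≡id y) ⟩
  inject₁ y                         ∎

liftPerm : Permutation′ k → Permutation′ (suc k)
liftPerm γ = permutation (liftTop (γ ⟨$⟩ʳ_)) (liftTop (γ ⟨$⟩ˡ_))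
  (liftTop-inverse (γ ⟨$⟩ˡ_) (γ ⟨$⟩ʳ_) (λ _ → inverseʳ γ))
  (liftTop-inverse (γ ⟨$⟩ʳ_) (γ ⟨$⟩ˡ_) (λ _ → inverseˡ γ))

dropTopView : {x : Fin (suc k)} → View x → Maybe (Fin k)
dropTopView ‵fromℕ        = nothing
dropTopView (‵inject₁ y) = just y

dropTop : Maybe (Fin (suc k)) → Maybe (Fin k)
dropTop nothing  = nothing
dropTop (just x) = dropTopView (view x)

dropTop-fromℕ : dropTop (just (fromℕ k)) ≡ nothing
dropTop-fromℕ {k} = cong dropTopView (view-fromℕ k)

dropTop-inject₁ : (y : Fin k) → dropTop (just (inject₁ y)) ≡ just y
dropTop-inject₁ y = cong dropTopView (view-inject₁ y)

dropTop-reflects : (c : Maybe (Fin (suc k))) (y : Fin k) → dropTop c ≡ just y → c ≡ just (inject₁ y)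
dropTop-reflects nothing  y ()
dropTop-reflects (just x) y e with top-or-old x
... | inj₁ refl with () ← trans (sym dropTop-fromℕ) e
... | inj₂ (z , refl) = cong (just ∘ inject₁) (just-injective (trans (sym (dropTop-inject₁ z)) e))

dropTop-liftTop : (f : Fin k → Fin k) (c : Maybe (Fin (suc k))) →
                  dropTop (M.map (liftTop f) c) ≡ M.map f (dropTop c)
dropTop-liftTop f nothing  = refl
dropTop-liftTop {k} f (just x) with top-or-old x
... | inj₁ refl = begin
  dropTop (just (liftTop f (fromℕ k))) ≡⟨ cong (dropTop ∘ just) (liftTop-fromℕ f) ⟩
  dropTop (just (fromℕ k))             ≡⟨ dropTop-fromℕ ⟩
  nothing                              ≡⟨ cong (M.map f) dropTop-fromℕ ⟨
  M.map f (dropTop (just (fromℕ k)))   ∎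
... | inj₂ (y , refl) = begin
  dropTop (just (liftTop f (inject₁ y))) ≡⟨ cong (dropTop ∘ just) (liftTop-inject₁ f y) ⟩
  dropTop (just (inject₁ (f y)))         ≡⟨ dropTop-inject₁ (f y) ⟩
  just (f y)                             ≡⟨ cong (M.map f) (dropTop-inject₁ y) ⟨
  M.map f (dropTop (just (inject₁ y)))   ∎

ExtendsCell : Maybe (Fin k) → Maybe (Fin (suc k)) → Set
ExtendsCell {k} p c = (c ≡ just (fromℕ k) × p ≡ nothing) ⊎ c ≡ M.map inject₁ p

dropTop-extends : (c : Maybe (Fin (suc k))) (p : Maybe (Fin k)) → dropTop c ≡ p → ExtendsCell p c
dropTop-extends nothing  p e = inj₂ (cong (M.map inject₁) e)
dropTop-extends (just x) p e with top-or-old x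
... | inj₁ refl       = inj₁ (refl , trans (sym e) dropTop-fromℕ)
... | inj₂ (y , refl) = inj₂ (cong (M.map inject₁) (trans (sym (dropTop-inject₁ y)) e))

_≐_ : Array r t → Array r t → Set
P ≐ Q = ∀ i j → P i j ≡ Q i j

mapSymbols : (Maybe (Fin s) → Maybe (Fin t)) → Array r s → Array r t
mapSymbols h P i j = h (P i j)

deleteTop : Array r (suc k) → Array r k
deleteTop = mapSymbols dropTop

extendsTo-deleteTop : (P′ : Array r k) (Q : Array r (suc k)) →
                      deleteTop Q ≐ P′ → ExtendsTo P′ Q
extendsTo-deleteTop P′ Q e i j = dropTop-extends (Q i j) (P′ i j) (e i j)

-- h reflects symbols along g: every symbol y in an output cell comes from
-- the symbol g y in the input cell.  This is all that self-orthogonality needs.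
Reflects : (Maybe (Fin s) → Maybe (Fin t)) → (Fin t → Fin s) → Set
Reflects {s} {t} h g = ∀ (c : Maybe (Fin s)) (y : Fin t) → h c ≡ just y → c ≡ just (g y)

sor-mapSymbols : (h : Maybe (Fin s) → Maybe (Fin t)) (g : Fin t → Fin s) → Reflects h g →
                 (P : Array r s) → IsSOR P → IsSOR (mapSymbols h P)
sor-mapSymbols h g refl-h P ((rows , cols) , orth) = (rows′ , cols′) , orth′
  where
  back : ∀ {i j y} → h (P i j) ≡ just y → P i j ≡ just (g y)
  back = refl-h _ _

  rows′ : ∀ i j j′ y → h (P i j) ≡ just y → h (P i j′) ≡ just y → j ≡ j′
  rows′ i j j′ y e e′ = rows i j j′ (g y) (back e) (back e′)

  cols′ : ∀ i i′ j y → h (P i j) ≡ just y → h (P i′ j) ≡ just y → i ≡ i′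
  cols′ i i′ j y e e′ = cols i i′ j (g y) (back e) (back e′)

  orth′ : Orthogonal (mapSymbols h P) (transpose (mapSymbols h P))
  orth′ c c′ y c≢c′ e e′ (z , f , f′) =
    orth c c′ (g y) c≢c′ (back e) (back e′) (g z , back f , back f′)

allUsed-mapSymbols : (h : Maybe (Fin s) → Maybe (Fin t)) →
                     (∀ y → Σ (Fin s) λ x → h (just x) ≡ just y) →
                     (P : Array r s) → AllSymbolsUsed P → AllSymbolsUsed (mapSymbols h P)
allUsed-mapSymbols h onto P used y with onto y
... | x , hx≡y with used x
...   | i , j , Pij≡x = i , j , trans (cong h Pij≡x) hx≡y

sorExact-deleteTop : (P : Array r (suc k)) → IsSORExact P → IsSORExact (deleteTop P)
sorExact-deleteTop P (sor , used) =
  sor-mapSymbols dropTop inject₁ dropTop-reflects P sor ,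
  allUsed-mapSymbols dropTop (λ y → inject₁ y , dropTop-inject₁ y) P used

sorExact-relabel : (γ : Permutation′ t) (P : Array r t) → IsSORExact P →
                   IsSORExact (mapSymbols (M.map (γ ⟨$⟩ʳ_)) P)
sorExact-relabel γ P (sor , used) =
  sor-mapSymbols (M.map (γ ⟨$⟩ʳ_)) (γ ⟨$⟩ˡ_) reflects P sor ,
  allUsed-mapSymbols (M.map (γ ⟨$⟩ʳ_)) (λ y → γ ⟨$⟩ˡ y , cong just (inverseʳ γ)) P used
  where
  reflects : Reflects (M.map (γ ⟨$⟩ʳ_)) (γ ⟨$⟩ˡ_)
  reflects nothing  y ()
  reflects (just x) y e = cong just (trans (sym (inverseˡ γ)) (cong (γ ⟨$⟩ˡ_) (just-injective e)))

reindex : (Fin r → Fin r) → Array r t → Array r t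
reindex f P i j = P (f i) (f j)

sor-reindex : (f : Fin r → Fin r) → Injective _≡_ _≡_ f →
              (P : Array r t) → IsSOR P → IsSOR (reindex f P)
sor-reindex f f-inj P ((rows , cols) , orth) = (rows′ , cols′) , orth′
  where
  rows′ : ∀ i j j′ y → P (f i) (f j) ≡ just y → P (f i) (f j′) ≡ just y → j ≡ j′
  rows′ i j j′ y e e′ = f-inj (rows (f i) (f j) (f j′) y e e′)

  cols′ : ∀ i i′ j y → P (f i) (f j) ≡ just y → P (f i′) (f j) ≡ just y → i ≡ i′
  cols′ i i′ j y e e′ = f-inj (cols (f i) (f i′) (f j) y e e′)

  orth′ : Orthogonal (reindex f P) (transpose (reindex f P))
  orth′ (i , j) (i′ , j′) y c≢c′ e e′ same =
    orth (f i , f j) (f i′ , f j′) y fc≢fc′ e e′ same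
    where
    fc≢fc′ : (f i , f j) ≢ (f i′ , f j′)
    fc≢fc′ eq = c≢c′ (cong₂ _,_ (f-inj (cong proj₁ eq)) (f-inj (cong proj₂ eq)))

allUsed-reindex : (f g : Fin r → Fin r) → (∀ i → f (g i) ≡ i) →
                  (P : Array r t) → AllSymbolsUsed P → AllSymbolsUsed (reindex f P)
allUsed-reindex f g f∘g≡id P used y with used y
... | i , j , Pij≡y = g i , g j , trans (cong₂ P (f∘g≡id i) (f∘g≡id j)) Pij≡y

sorExact-reindex : (α : Permutation′ r) (P : Array r t) → IsSORExact P →
                   IsSORExact (reindex (α ⟨$⟩ˡ_) P)
sorExact-reindex α P (sor , used) =
  sor-reindex (α ⟨$⟩ˡ_) αˡ-injective P sor ,
  allUsed-reindex (α ⟨$⟩ˡ_) (α ⟨$⟩ʳ_) (λ _ → inverseˡ α) P used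
  where
  αˡ-injective : Injective _≡_ _≡_ (α ⟨$⟩ˡ_)
  αˡ-injective e = trans (sym (inverseʳ α)) (trans (cong (α ⟨$⟩ʳ_) e) (inverseʳ α))

-- Transposition exchanges the roles of rows and columns and of P and Pᵗ.
sorExact-transpose : (P : Array r t) → IsSORExact P → IsSORExact (transpose P)
sorExact-transpose P (((rows , cols) , orth) , used) = ((rows′ , cols′) , orth′) , used′
  where
  rows′ : ∀ i j j′ y → P j i ≡ just y → P j′ i ≡ just y → j ≡ j′
  rows′ i j j′ = cols j j′ i

  cols′ : ∀ i i′ j y → P j i ≡ just y → P j i′ ≡ just y → i ≡ i′
  cols′ i i′ j = rows j i i′

  orth′ : Orthogonal (transpose P) (transpose (transpose P))
  orth′ c c′ y c≢c′ e e′ (z , f , f′) = orth c c′ z c≢c′ f f′ (y , e , e′)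

  used′ : AllSymbolsUsed (transpose P)
  used′ y with used y
  ... | i , j , Pij≡y = j , i , Pij≡y

sorExact-paratopism : (α : Permutation′ r) (γ : Permutation′ t) (π : Bool) (P : Array r t) →
                      IsSORExact P → IsSORExact (paratopism α γ π P)
sorExact-paratopism α γ false P sorP =
  sorExact-relabel γ _ (sorExact-reindex α P sorP)
sorExact-paratopism α γ true  P sorP =
  sorExact-relabel γ _ (sorExact-reindex α (transpose P) (sorExact-transpose P sorP))

paratopism-cong : (α : Permutation′ r) (γ : Permutation′ t) (π : Bool) {P Q : Array r t} →
                  P ≐ Q → paratopism α γ π P ≐ paratopism α γ π Q
paratopism-cong α γ false P≐Q i j = cong (M.map (γ ⟨$⟩ʳ_)) (P≐Q (α ⟨$⟩ˡ i) (α ⟨$⟩ˡ j))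
paratopism-cong α γ true  P≐Q i j = cong (M.map (γ ⟨$⟩ʳ_)) (P≐Q (α ⟨$⟩ˡ j) (α ⟨$⟩ˡ i))

relabel-inverse : (γ : Permutation′ t) (c : Maybe (Fin t)) →
                  M.map (γ ⟨$⟩ˡ_) (M.map (γ ⟨$⟩ʳ_) c) ≡ c
relabel-inverse γ nothing  = refl
relabel-inverse γ (just x) = cong just (inverseˡ γ)

-- (α⁻¹, γ⁻¹, π) undoes (α, γ, π); for π = (12) the two transpositions cancel.
paratopism-inverse : (α : Permutation′ r) (γ : Permutation′ t) (π : Bool) (P : Array r t) →
                     paratopism (flip α) (flip γ) π (paratopism α γ π P) ≐ P
paratopism-inverse α γ false P i j = trans (relabel-inverse γ _) (cong₂ P (inverseˡ α) (inverseˡ α))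
paratopism-inverse α γ true  P i j = trans (relabel-inverse γ _) (cong₂ P (inverseˡ α) (inverseˡ α))

deleteTop-paratopism : (α : Permutation′ r) (γ : Permutation′ k) (π : Bool) (P : Array r (suc k)) →
                       deleteTop (paratopism α (liftPerm γ) π P) ≐ paratopism α γ π (deleteTop P)
deleteTop-paratopism α γ false P i j = dropTop-liftTop (γ ⟨$⟩ʳ_) (P (α ⟨$⟩ˡ i) (α ⟨$⟩ˡ j))
deleteTop-paratopism α γ true  P i j = dropTop-liftTop (γ ⟨$⟩ʳ_) (P (α ⟨$⟩ˡ j) (α ⟨$⟩ˡ i))

lemma6 : (r k m : ℕ) → 1 ≤ r → (Reps : Fin m → Array r k) → IsMainClassReps Reps →
         (P : Array r (suc k)) → IsSORExact P →
         Σ (Fin m) λ a → Σ (Array r (suc k)) λ Q → IsSORExtending (Reps a) Q × SameMainClass P Q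
lemma6 r k _ _ Reps (_ , classify , _) P sorP
  with classify (deleteTop P) (sorExact-deleteTop P sorP)
... | a , α , γ , π , Rep↦P′ =
  a , Q , (sorExact-paratopism α⁻¹ δ π P sorP , extendsTo-deleteTop (Reps a) Q Q-restricts) ,
  (α⁻¹ , δ , π , λ _ _ → refl)
  where
  α⁻¹ : Permutation′ r
  α⁻¹ = flip α

  γ⁻¹ : Permutation′ k
  γ⁻¹ = flip γ

  δ : Permutation′ (suc k)
  δ = liftPerm γ⁻¹

  Q : Array r (suc k)
  Q = paratopism α⁻¹ δ π P

  Q-restricts : deleteTop Q ≐ Reps a
  Q-restricts i j = begin
    deleteTop Q i j                                       ≡⟨ deleteTop-paratopism α⁻¹ γ⁻¹ π P i j ⟩
    paratopism α⁻¹ γ⁻¹ π (deleteTop P) i j                ≡⟨ paratopism-cong α⁻¹ γ⁻¹ π (λ x y → sym (Rep↦P′ x y)) i j ⟩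
    paratopism α⁻¹ γ⁻¹ π (paratopism α γ π (Reps a)) i j  ≡⟨ paratopism-inverse α γ π (Reps a) i j ⟩
    Reps a i j                                            ∎
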